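{- Let $p$ be a prime and $l\in\mathbb{N}$. Suppose $P,R\in\mathcal{X}_{p^l}$ are adjacent in $\mathcal{F}_{p^l}$, written in lowest terms as $P=u/v$, $R=r/s$ (with $\infty=1/0$). For $k\in\mathbb{N}$ let $(\oplus_kP)\oplus R$ denote the rational number $\frac{ku+r}{kv+s}$. Then there exists a natural number $k<p$ such that $(\oplus_kP)\oplus R\notin\mathcal{X}_{p^l}$.
   Context: $\mathcal{X}_{p^l}=\{x/y: x,y\in\mathbb{Z},\ y>0,\ \gcd(x,y)=1,\ p^l\mid y\}\cup\{\infty\}$. The graph $\mathcal{F}_{p^l}$ has vertex set $\mathcal{X}_{p^l}$, and vertices $p/q$, $r/s$ (lowest terms, $\infty=1/0$) are adjacent iff $rq-sp=\pm p^l$. Membership of a rational number in $\mathcal{X}_{p^l}$ refers to its reduced form. -}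

module Defs where

open import Data.Nat using (ℕ; zero; suc; _^_; _*_; _+_)
open import Data.Nat.Divisibility using (_∣_)
open import Data.Integer as ℤ using (ℤ; +_; -_)
open import Data.Rational using (ℚ; _/_)
import Data.Rational as ℚ
open import Data.Unit using (⊤)
open import Data.Sum using (_⊎_)
open import Relation.Binary.PropositionalEquality using (_≡_)

data ℚ∞ : Set where
  ∞   : ℚ∞
  fin : ℚ → ℚ∞

num : ℚ∞ → ℤ
num ∞       = + 1
num (fin q) = ℚ.numerator q

den : ℚ∞ → ℕ
den ∞       = 0
den (fin q) = ℚ.denominatorℕ q

InX : ℕ → ℕ → ℚ∞ → Set
InX p l ∞       = ⊤
InX p l (fin q) = p ^ l ∣ ℚ.denominatorℕ q

Adjacent : ℕ → ℕ → ℚ∞ → ℚ∞ → Set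
Adjacent p l P R =
  (num R ℤ.* (+ den P) ℤ.- (+ den R) ℤ.* num P ≡ + (p ^ l)) ⊎
  (num R ℤ.* (+ den P) ℤ.- (+ den R) ℤ.* num P ≡ - (+ (p ^ l)))

-- The extended rational a/b (b = 0 gives ∞; 0/0 never arises below).
frac : ℤ → ℕ → ℚ∞
frac a zero    = ∞
frac a (suc n) = fin (a / suc n)

comb : ℕ → ℚ∞ → ℚ∞ → ℚ∞
comb k P R = frac ((+ k) ℤ.* num P ℤ.+ num R) (k * den P + den R)

-- Since p^l divides the denominator v of P = u/v, which is coprime to u, the prime p does
-- not divide u; so some k < p makes p divide the numerator ku + r. The determinant of the
-- pair (ku + r, kv + s), (u, v) is still ±p^l, so p^(l+1) cannot divide kv + s: otherwise it
-- would divide both (ku + r)v and (kv + s)u, hence p^l. A fraction whose numerator is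
-- divisible by p while p^(l+1) does not divide its denominator loses a factor p on reduction,
-- so its reduced denominator is not divisible by p^l.
module Submission where

open import Defs
open import Data.Nat using (ℕ; _<_; _≤_)
open import Data.Nat.Primality using (Prime)
open import Data.Product using (∃-syntax; _×_)
open import Relation.Nullary using (¬_)

open import Data.Nat as ℕ using (suc; _^_; NonZero; nonTrivial⇒≢1)
import Data.Nat.Properties as ℕ
open import Data.Nat.Divisibility as ℕ using (_∣_; _∣0)
open import Data.Nat.Coprimality as Coprime using (Coprime; coprime-Bézout; 1-coprimeTo)
open import Data.Nat.GCD using (gcd; module Bézout)
open import Data.Nat.Primality using (euclidsLemma; prime⇒irreducible; prime⇒nonTrivial; prime⇒nonZero)
open import Data.Integer as ℤ using (ℤ; +_; -_; ∣_∣; 1ℤ)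
import Data.Integer.Properties as ℤ
open import Data.Integer.Divisibility.Signed as ℤ∣
  using (divides; ∣ᵤ⇒∣; ∣⇒∣ᵤ) renaming (_∣_ to _∣ℤ_)
open import Data.Integer.DivMod using (_%ℕ_; _/ℕ_; a≡a%ℕn+[a/ℕn]*n; n%ℕd<d)
open import Data.Rational using (mkℚ; _/_; ↥_; ↧ₙ_)
open import Data.Rational.Properties using (↥-/; ↧-/)
open import Data.Product using (_,_)
open import Data.Sum using (inj₁; inj₂)
open import Relation.Nullary using (contradiction)
open import Relation.Binary.PropositionalEquality
open import Data.Integer.Tactic.RingSolver using (solve-∀)

prime⇒≢1 : ∀ {p} → Prime p → p ≢ 1
prime⇒≢1 p-prime = nonTrivial⇒≢1 {{prime⇒nonTrivial p-prime}}

prime∤⇒coprime : ∀ {p n} → Prime p → ¬ p ∣ n → Coprime n p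
prime∤⇒coprime p-prime p∤n (i∣n , i∣p) with prime⇒irreducible p-prime i∣p
... | inj₁ i≡1 = i≡1
... | inj₂ refl = contradiction i∣n p∤n

m∣m^n : ∀ {m n} → 1 ≤ n → m ∣ m ^ n
m∣m^n {m} {suc n} _ = ℕ.m∣m*n (m ^ n)

prime*m∤m : ∀ {p m} .{{_ : NonZero m}} → Prime p → ¬ p ℕ.* m ∣ m
prime*m∤m {p} {m} p-prime p*m∣m =
  prime⇒≢1 p-prime (ℕ.∣1⇒≡1 (ℕ.*-cancelʳ-∣ m (subst (p ℕ.* m ∣_) (sym (ℕ.*-identityˡ m)) p*m∣m)))

pos-1+* : ∀ a b c d → 1 ℕ.+ a ℕ.* b ≡ c ℕ.* d → 1ℤ ℤ.+ + a ℤ.* + b ≡ + c ℤ.* + d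
pos-1+* a b c d eq = begin
  1ℤ ℤ.+ + a ℤ.* + b  ≡⟨ cong (λ j → 1ℤ ℤ.+ j) (ℤ.pos-* a b) ⟨
  + (1 ℕ.+ a ℕ.* b)   ≡⟨ cong +_ eq ⟩
  + (c ℕ.* d)         ≡⟨ ℤ.pos-* c d ⟩
  + c ℤ.* + d         ∎
  where open ≡-Reasoning

bézout⇒inverse : ∀ {m p} → Bézout.Identity 1 m p → ∃[ x ] (+ p ∣ℤ x ℤ.* + m ℤ.- 1ℤ)
bézout⇒inverse {m} {p} (Bézout.+- x y eq) = + x , divides (+ y) (begin
  + x ℤ.* + m ℤ.- 1ℤ           ≡⟨ cong (ℤ._- 1ℤ) (pos-1+* y p x m eq) ⟨
  1ℤ ℤ.+ + y ℤ.* + p ℤ.- 1ℤ    ≡⟨ [1+i]-1≡i (+ y ℤ.* + p) ⟩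
  + y ℤ.* + p                  ∎)
  where
  open ≡-Reasoning
  [1+i]-1≡i : ∀ i → 1ℤ ℤ.+ i ℤ.- 1ℤ ≡ i
  [1+i]-1≡i = solve-∀
bézout⇒inverse {m} {p} (Bézout.-+ x y eq) = - + x , divides (- + y) (begin
  - + x ℤ.* + m ℤ.- 1ℤ         ≡⟨ -i*j-1≡-[1+i*j] (+ x) (+ m) ⟩
  - (1ℤ ℤ.+ + x ℤ.* + m)       ≡⟨ cong -_ (pos-1+* x m y p eq) ⟩
  - (+ y ℤ.* + p)              ≡⟨ ℤ.neg-distribˡ-* (+ y) (+ p) ⟩
  - + y ℤ.* + p                ∎)
  where
  open ≡-Reasoning
  -i*j-1≡-[1+i*j] : ∀ i j → - i ℤ.* j ℤ.- 1ℤ ≡ - (1ℤ ℤ.+ i ℤ.* j)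
  -i*j-1≡-[1+i*j] = solve-∀

coprime⇒inverse : ∀ {p} u → Coprime ∣ u ∣ p → ∃[ x ] (+ p ∣ℤ x ℤ.* u ℤ.- 1ℤ)
coprime⇒inverse {p} u coprime with bézout⇒inverse (coprime-Bézout coprime) | ℤ.+∣i∣≡i⊎+∣i∣≡-i u
... | x , p∣x∣u∣-1 | inj₁ ∣u∣≡u  = x , subst (λ v → + p ∣ℤ x ℤ.* v ℤ.- 1ℤ) ∣u∣≡u p∣x∣u∣-1
... | x , p∣x∣u∣-1 | inj₂ ∣u∣≡-u =
  - x , subst (+ p ∣ℤ_) (trans (cong (λ v → x ℤ.* v ℤ.- 1ℤ) ∣u∣≡-u) (i*-j≡-i*j x u)) p∣x∣u∣-1
  where
  i*-j≡-i*j : ∀ i j → i ℤ.* - j ℤ.- 1ℤ ≡ - i ℤ.* j ℤ.- 1ℤ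
  i*-j≡-i*j = solve-∀

∣i-i%ℕd : ∀ i d .{{_ : NonZero d}} → + d ∣ℤ i ℤ.- + (i %ℕ d)
∣i-i%ℕd i d = divides (i /ℕ d) (begin
  i ℤ.- + r                 ≡⟨ cong (ℤ._- + r) (a≡a%ℕn+[a/ℕn]*n i d) ⟩
  + r ℤ.+ q ℤ.* + d ℤ.- + r  ≡⟨ [j+i]-j≡i (q ℤ.* + d) (+ r) ⟩
  q ℤ.* + d                 ∎)
  where
  open ≡-Reasoning
  r = i %ℕ d
  q = i /ℕ d
  [j+i]-j≡i : ∀ i j → j ℤ.+ i ℤ.- j ≡ i
  [j+i]-j≡i = solve-∀

linear-congruence : ∀ {p} .{{_ : NonZero p}} {u} → ∃[ x ] (+ p ∣ℤ x ℤ.* u ℤ.- 1ℤ) →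
                    ∀ r → ∃[ k ] (k < p × + p ∣ℤ + k ℤ.* u ℤ.+ r)
linear-congruence {p} {u} (x , p∣xu-1) r = k , n%ℕd<d k₀ p , p∣ku+r
  where
  -- k₀ = -rx solves the congruence; k is its least non-negative residue.
  k₀ = - (r ℤ.* x)
  k = k₀ %ℕ p
  p∣k₀u+r : + p ∣ℤ k₀ ℤ.* u ℤ.+ r
  p∣k₀u+r = subst (+ p ∣ℤ_) (-[r*[xu-1]]≡-[rx]u+r r x u) (ℤ∣.∣m⇒∣-m (ℤ∣.∣n⇒∣m*n r p∣xu-1))
    where
    -[r*[xu-1]]≡-[rx]u+r : ∀ r x u → - (r ℤ.* (x ℤ.* u ℤ.- 1ℤ)) ≡ - (r ℤ.* x) ℤ.* u ℤ.+ r
    -[r*[xu-1]]≡-[rx]u+r = solve-∀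
  p∣ku+r : + p ∣ℤ + k ℤ.* u ℤ.+ r
  p∣ku+r = subst (+ p ∣ℤ_) (au+r-[a-b]u≡bu+r k₀ (+ k) u r)
    (ℤ∣.∣m∣n⇒∣m-n p∣k₀u+r (ℤ∣.∣m⇒∣m*n u (∣i-i%ℕd k₀ p)))
    where
    au+r-[a-b]u≡bu+r : ∀ a b u r → a ℤ.* u ℤ.+ r ℤ.- (a ℤ.- b) ℤ.* u ≡ b ℤ.* u ℤ.+ r
    au+r-[a-b]u≡bu+r = solve-∀

num-den-coprime : ∀ P → Coprime ∣ num P ∣ (den P)
num-den-coprime ∞       = 1-coprimeTo 0
num-den-coprime (fin (mkℚ _ _ coprime)) = Coprime.recompute coprime

p*↧ₙ[i/n]∣n : ∀ {p} i n .{{_ : NonZero n}} → Prime p → p ∣ ∣ i ∣ → p ∣ ↧ₙ (i / n) →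
              p ℕ.* ↧ₙ (i / n) ∣ n
p*↧ₙ[i/n]∣n {p} i n p-prime p∣i p∣D = subst (p ℕ.* D ∣_) D*g≡n p*D∣D*g
  where
  q = i / n
  D = ↧ₙ q
  g = gcd ∣ i ∣ n
  D*g≡n : D ℕ.* g ≡ n
  D*g≡n = ℤ.+-injective (trans (ℤ.pos-* D g) (↧-/ i n))
  ∣N∣*g≡∣i∣ : ∣ ↥ q ∣ ℕ.* g ≡ ∣ i ∣
  ∣N∣*g≡∣i∣ = trans (sym (ℤ.abs-* (↥ q) (+ g))) (cong ∣_∣ (↥-/ i n))
  p∣g : p ∣ g
  p∣g with euclidsLemma ∣ ↥ q ∣ g p-prime (subst (p ∣_) (sym ∣N∣*g≡∣i∣) p∣i)
  ... | inj₁ p∣N = contradiction (num-den-coprime (fin q) (p∣N , p∣D)) (prime⇒≢1 p-prime)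
  ... | inj₂ p∣g = p∣g
  p*D∣D*g : p ℕ.* D ∣ D ℕ.* g
  p*D∣D*g = subst (p ℕ.* D ∣_) (ℕ.*-comm g D) (ℕ.*-monoˡ-∣ D p∣g)

frac∉X : ∀ {p l a} d → Prime p → 1 ≤ l → p ∣ ∣ a ∣ → ¬ p ^ suc l ∣ d → ¬ InX p l (frac a d)
frac∉X ℕ.zero    _       _   _   p^[1+l]∤0 _      = p^[1+l]∤0 (_ ∣0)
frac∉X {p} {a = a} (suc n) p-prime 1≤l p∣a p^[1+l]∤d p^l∣D =
  p^[1+l]∤d (ℕ.∣-trans (ℕ.*-monoʳ-∣ p p^l∣D)
                       (p*↧ₙ[i/n]∣n a (suc n) p-prime p∣a (ℕ.∣-trans (m∣m^n 1≤l) p^l∣D)))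

InX⇒∣den : ∀ {p l} P → InX p l P → p ^ l ∣ den P
InX⇒∣den ∞       _     = _ ∣0
InX⇒∣den (fin q) p^l∣q = p^l∣q

det : ℚ∞ → ℚ∞ → ℤ
det P R = num R ℤ.* + den P ℤ.- + den R ℤ.* num P

Adjacent⇒∣det∣≡ : ∀ {p l} P R → Adjacent p l P R → ∣ det P R ∣ ≡ p ^ l
Adjacent⇒∣det∣≡ P R (inj₁ det≡p^l)  = cong ∣_∣ det≡p^l
Adjacent⇒∣det∣≡ P R (inj₂ det≡-p^l) = trans (cong ∣_∣ det≡-p^l) (ℤ.∣-i∣≡∣i∣ (+ _))

det-shear : ∀ k P R →
  det P R ≡ (+ k ℤ.* num P ℤ.+ num R) ℤ.* + den P ℤ.- + (k ℕ.* den P ℕ.+ den R) ℤ.* num P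
det-shear k P R = begin
  det P R                              ≡⟨ shear (+ k) u (+ v) r (+ s) ⟩
  x ℤ.* + v ℤ.- (+ k ℤ.* + v ℤ.+ + s) ℤ.* u ≡⟨ cong (λ y → x ℤ.* + v ℤ.- y ℤ.* u) kv+s ⟩
  x ℤ.* + v ℤ.- + (k ℕ.* v ℕ.+ s) ℤ.* u     ∎
  where
  open ≡-Reasoning
  u = num P
  v = den P
  r = num R
  s = den R
  x = + k ℤ.* u ℤ.+ r
  kv+s : + k ℤ.* + v ℤ.+ + s ≡ + (k ℕ.* v ℕ.+ s)
  kv+s = trans (cong (ℤ._+ + s) (sym (ℤ.pos-* k v))) (sym (ℤ.pos-+ (k ℕ.* v) s))
  shear : ∀ k u v r s → r ℤ.* v ℤ.- s ℤ.* u ≡ (k ℤ.* u ℤ.+ r) ℤ.* v ℤ.- (k ℤ.* v ℤ.+ s) ℤ.* u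
  shear = solve-∀

adjacent⇒p^[1+l]∤ : ∀ {p l} k P R → Prime p → Adjacent p l P R → p ^ l ∣ den P →
                    p ∣ ∣ + k ℤ.* num P ℤ.+ num R ∣ → ¬ p ^ suc l ∣ k ℕ.* den P ℕ.+ den R
adjacent⇒p^[1+l]∤ {p} {l} k P R p-prime adjacent p^l∣v p∣ku+r p^[1+l]∣kv+s =
  prime*m∤m {m = p ^ l} p-prime
    (subst (p ^ suc l ∣_) (Adjacent⇒∣det∣≡ {p} {l} P R adjacent) (∣⇒∣ᵤ p^[1+l]∣det))
  where
  instance _ = ℕ.m^n≢0 p l {{prime⇒nonZero p-prime}}
  x = + k ℤ.* num P ℤ.+ num R
  p^[1+l]∣xv : + p ^ suc l ∣ℤ x ℤ.* + den P
  p^[1+l]∣xv = ∣ᵤ⇒∣ (subst (p ^ suc l ∣_) (sym (ℤ.abs-* x (+ den P)))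
                             (ℕ.*-pres-∣ p∣ku+r p^l∣v))
  p^[1+l]∣yu : + p ^ suc l ∣ℤ + (k ℕ.* den P ℕ.+ den R) ℤ.* num P
  p^[1+l]∣yu = ℤ∣.∣m⇒∣m*n (num P) (∣ᵤ⇒∣ {i = + (k ℕ.* den P ℕ.+ den R)} p^[1+l]∣kv+s)
  p^[1+l]∣det : + p ^ suc l ∣ℤ det P R
  p^[1+l]∣det = subst (+ p ^ suc l ∣ℤ_) (sym (det-shear k P R))
                      (ℤ∣.∣m∣n⇒∣m-n p^[1+l]∣xv p^[1+l]∣yu)

mainTheorem5 : (p l : ℕ) → Prime p → 1 ≤ l → (P R : ℚ∞) →
    InX p l P → InX p l R → Adjacent p l P R →
    ∃[ k ] (k < p × ¬ InX p l (comb k P R))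
mainTheorem5 p l p-prime 1≤l P R P∈X _ adjacent =
  let k , k<p , p∣ku+r = linear-congruence (coprime⇒inverse (num P) u-coprime-p) (num R)
      p∣∣ku+r∣ = ∣⇒∣ᵤ p∣ku+r
      p^[1+l]∤kv+s = adjacent⇒p^[1+l]∤ {l = l} k P R p-prime adjacent p^l∣v p∣∣ku+r∣
  in k , k<p , frac∉X _ p-prime 1≤l p∣∣ku+r∣ p^[1+l]∤kv+s
  where
  instance _ = prime⇒nonZero p-prime
  p^l∣v : p ^ l ∣ den P
  p^l∣v = InX⇒∣den P P∈X
  u-coprime-p : Coprime ∣ num P ∣ p
  u-coprime-p = prime∤⇒coprime p-prime λ p∣u →
    prime⇒≢1 p-prime (num-den-coprime P (p∣u , ℕ.∣-trans (m∣m^n 1≤l) p^l∣v))
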